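{- Let $n$ be a positive integer and ${\mathrm T}_m=\binom{m+1}{2}$. Then the sequences $({\mathrm T}_n,{\mathrm T}_{n+1},{\mathrm T}_{n+2})$ and $({\mathrm T}_{n+2},{\mathrm T}_{n+1},{\mathrm T}_n)$ are telescopic.
   Context: Let $(a_1,\ldots,a_k)$ ($k\ge2$) be a sequence of positive integers with $\gcd\{a_1,\ldots,a_k\}=1$, and let $d_i=\gcd\{a_1,\ldots,a_i\}$ for $i=1,\ldots,k$. The sequence is telescopic if, for every $i=2,\ldots,k$, the integer $a_i/d_i$ is a non-negative integer linear combination of $a_1/d_{i-1},\ldots,a_{i-1}/d_{i-1}$. -}

module Defs where

open import Data.Nat using (ℕ; zero; suc; _+_; _*_; _/_; _≤_; _<_)
open import Data.Nat.GCD using (gcd)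
open import Data.Nat.Combinatorics using (_C_)
open import Data.Fin using (Fin; toℕ; fromℕ<; inject≤)
open import Data.List using (List; []; _∷_; length; lookup; take; foldr; zipWith; map)
open import Data.Nat.ListAction using (sum)
open import Data.Product using (∃; Σ; _×_; _,_)
open import Relation.Binary.PropositionalEquality using (_≡_)

-- truncated division: x div 0 = 0, otherwise ordinary quotient.
-- (only ever used with positive divisor, where it is exact division)
_div_ : ℕ → ℕ → ℕ
x div zero = 0
x div suc d = x / suc d

gcdList : List ℕ → ℕ
gcdList = foldr gcd 0

d : List ℕ → ℕ → ℕ
d as i = gcdList (take i as)

IsNNComb : ℕ → List ℕ → Set
IsNNComb x bs = Σ (List ℕ) λ cs → length cs ≡ length bs × x ≡ sum (zipWith _*_ cs bs)

data AllPos : List ℕ → Set where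
  []  : AllPos []
  _∷_ : ∀ {x xs} → 0 < x → AllPos xs → AllPos (x ∷ xs)

-- Telescopic sequence (a_1,...,a_k), k ≥ 2, positive entries, gcd 1, and
-- for every i = 2..k:  a_i / d_i  is an NN-combination of
--   a_1/d_{i-1}, ..., a_{i-1}/d_{i-1}.
-- We write i = suc j (so j = i-1 ranges over 1..k-1, and a_i is the list
-- element at 0-based index j).
Telescopic : List ℕ → Set
Telescopic as =
  2 ≤ length as × AllPos as × gcdList as ≡ 1 ×
  (∀ (j : ℕ) (lt : j < length as) → 1 ≤ j →
     IsNNComb (lookup as (fromℕ< lt) div d as (suc j))
              (map (λ x → x div d as j) (take j as)))

T : ℕ → ℕ
T m = suc m C 2

-- Write T m = h m · h (m + 1), where h m is m for odd m and m / 2 for even m. Then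
-- T n, T (n + 1), T (n + 2) are u v, v w, w t with u ⊥ w, v ⊥ w and v ⊥ t (explicit
-- linear relations, separately for n odd and n even). Hence gcd (u v, v w) = v,
-- gcd (v, w t) = 1 and w t is a multiple of w = v w / v, which for three terms is all
-- that telescopicity asks; the reversed sequence is the same with v and w exchanged.
module Submission where

open import Defs
open import Data.Nat using (ℕ; _<_; _+_)
open import Data.List using ([]; _∷_)
open import Data.Product using (_×_)

open import Data.Nat using (zero; suc; _*_; z≤n; s≤s; z<s)
open import Data.Nat.Properties using (*-cancelʳ-≡; *-comm; +-identityʳ; *-identityʳ; *-mono-<; +-suc; *-distribʳ-+)
open import Data.Nat.GCD using (gcd; gcd-assoc; gcd-identityʳ; c*gcd[m,n]≡gcd[cm,cn])
open import Data.Nat.Coprimality as Coprime using (Coprime; coprime⇒gcd≡1; coprime-divisor)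
open import Data.Nat.Divisibility using (_∣_; ∣1⇒≡1; ∣m+n∣m⇒∣n; ∣m⇒∣m*n; ∣-trans)
open import Data.Nat.DivMod using (n/n≡1; m*n/n≡m; n/1≡n)
open import Data.Nat.Combinatorics using (nCk+nC[k+1]≡[n+1]C[k+1]; nC1≡n)
open import Data.Nat.Tactic.RingSolver using (solve)
open import Data.Product using (_,_; ∃)
open import Data.Sum using (_⊎_; inj₁; inj₂)
open import Relation.Binary.PropositionalEquality

coprime-by-linear-relation : ∀ x y α β → x * α + 1 ≡ y * β → Coprime x y
coprime-by-linear-relation _ _ α β eq {i} (i∣x , i∣y) =
  ∣1⇒≡1 (∣m+n∣m⇒∣n (subst (i ∣_) (sym eq) (∣m⇒∣m*n β i∣y)) (∣m⇒∣m*n α i∣x))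

coprime-* : ∀ {x y z} → Coprime x y → Coprime x z → Coprime x (y * z)
coprime-* {y = y} x⊥y x⊥z {i} (i∣x , i∣yz) = x⊥z (i∣x , coprime-divisor i⊥y i∣yz)
  where
  i⊥y : Coprime i y
  i⊥y (j∣i , j∣y) = x⊥y (∣-trans j∣i i∣x , j∣y)

gcd-*ʳ-coprime : ∀ {p q} s → Coprime p q → gcd (p * s) (q * s) ≡ s
gcd-*ʳ-coprime {p} {q} s p⊥q = begin
  gcd (p * s) (q * s) ≡⟨ cong₂ gcd (*-comm p s) (*-comm q s) ⟩
  gcd (s * p) (s * q) ≡⟨ c*gcd[m,n]≡gcd[cm,cn] s p q ⟨
  s * gcd p q         ≡⟨ cong (s *_) (coprime⇒gcd≡1 p⊥q) ⟩
  s * 1               ≡⟨ *-identityʳ s ⟩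
  s                   ∎
  where open ≡-Reasoning

telescopic-triple : ∀ {a b c} → 0 < a → 0 < b → 0 < c → gcd (gcd a b) c ≡ 1 →
  IsNNComb c (a div gcd a b ∷ b div gcd a b ∷ []) → Telescopic (a ∷ b ∷ c ∷ [])
telescopic-triple {a} {b} {c} 0<a 0<b 0<c gcd≡1 (cs , len , c≡comb) =
  s≤s (s≤s z≤n) , 0<a ∷ 0<b ∷ 0<c ∷ [] , d₃≡1 , λ
    { 1 _ _ → b/d₂ ∷ [] , refl ,
        sym (trans (cong (λ x → b/d₂ * x + 0) (div-gcd-self 0<a)) (trans (+-identityʳ _) (*-identityʳ b/d₂)))
    ; 2 _ _ → subst₂ (λ x y → IsNNComb (c div x) (a div y ∷ b div y ∷ [])) (sym d₃≡1) (sym d₂≡gcd-ab)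
        (cs , len , trans (n/1≡n c) c≡comb)
    ; (suc (suc (suc _))) (s≤s (s≤s (s≤s ())))
    }
  where
  d₂≡gcd-ab : gcd a (gcd b 0) ≡ gcd a b
  d₂≡gcd-ab = cong (gcd a) (gcd-identityʳ b)
  d₃≡1 : gcd a (gcd b (gcd c 0)) ≡ 1
  d₃≡1 = trans (cong (λ x → gcd a (gcd b x)) (gcd-identityʳ c)) (trans (sym (gcd-assoc a b c)) gcd≡1)
  b/d₂ : ℕ
  b/d₂ = b div gcd a (gcd b 0)
  div-gcd-self : ∀ {m} → 0 < m → m div gcd m 0 ≡ 1
  div-gcd-self {suc m} _ = n/n≡1 (suc m)

telescopic-of-coprime-factors : ∀ {a b c p q r} g → 0 < a → 0 < b → 0 < c →
  a ≡ p * suc g → b ≡ q * suc g → c ≡ r * q → Coprime p q → Coprime (suc g) c →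
  Telescopic (a ∷ b ∷ c ∷ [])
telescopic-of-coprime-factors {a} {b} {c} {q = q} {r = r} g 0<a 0<b 0<c refl refl refl p⊥q g⊥c =
  telescopic-triple 0<a 0<b 0<c
    (trans (cong (λ x → gcd x c) gcd-ab) (coprime⇒gcd≡1 g⊥c))
    (0 ∷ r ∷ [] , refl , sym (trans (cong (λ x → r * x + 0) b/g≡q) (+-identityʳ (r * q))))
  where
  gcd-ab : gcd a b ≡ suc g
  gcd-ab = gcd-*ʳ-coprime (suc g) p⊥q
  b/g≡q : b div gcd a b ≡ q
  b/g≡q = trans (cong (b div_) gcd-ab) (m*n/n≡m q (suc g))

TelescopicBothWays : ℕ → ℕ → ℕ → Set
TelescopicBothWays a b c = Telescopic (a ∷ b ∷ c ∷ []) × Telescopic (c ∷ b ∷ a ∷ [])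

telescopic-both-ways : ∀ {a b c u v w t} → 0 < u → 0 < v → 0 < w → 0 < t →
  a ≡ u * v → b ≡ v * w → c ≡ w * t → Coprime u w → Coprime v w → Coprime v t →
  TelescopicBothWays a b c
telescopic-both-ways {a} {b} {c} {u} {suc v} {suc w} {t} 0<u 0<v 0<w 0<t a≡uv b≡vw c≡wt u⊥w v⊥w v⊥t =
  telescopic-of-coprime-factors {r = t} v 0<a 0<b 0<c a≡uv (trans b≡vw (*-comm (suc v) (suc w)))
    (trans c≡wt (*-comm (suc w) t)) u⊥w (subst (Coprime (suc v)) (sym c≡wt) (coprime-* v⊥w v⊥t)) ,
  telescopic-of-coprime-factors {r = u} w 0<c 0<b 0<a (trans c≡wt (*-comm (suc w) t)) b≡vw a≡uv
    (Coprime.sym v⊥t) (subst (Coprime (suc w)) (sym a≡uv) (coprime-* (Coprime.sym u⊥w) (Coprime.sym v⊥w)))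
  where
  0<a : 0 < a
  0<a = subst (0 <_) (sym a≡uv) (*-mono-< 0<u 0<v)
  0<b : 0 < b
  0<b = subst (0 <_) (sym b≡vw) (*-mono-< 0<v 0<w)
  0<c : 0 < c
  0<c = subst (0 <_) (sym c≡wt) (*-mono-< 0<w 0<t)

T-suc : ∀ m → T (suc m) ≡ suc m + T m
T-suc m = trans (sym (nCk+nC[k+1]≡[n+1]C[k+1] (suc m) 1)) (cong (_+ T m) (nC1≡n (suc m)))

T*2≡m*[1+m] : ∀ m → T m * 2 ≡ m * suc m
T*2≡m*[1+m] zero    = refl
T*2≡m*[1+m] (suc m) = begin
  T (suc m) * 2           ≡⟨ cong (_* 2) (T-suc m) ⟩
  (suc m + T m) * 2       ≡⟨ *-distribʳ-+ 2 (suc m) (T m) ⟩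
  suc m * 2 + T m * 2     ≡⟨ cong (suc m * 2 +_) (T*2≡m*[1+m] m) ⟩
  suc m * 2 + m * suc m   ≡⟨ solve (m ∷ []) ⟩
  suc m * suc (suc m)     ∎
  where open ≡-Reasoning

x*2≡m*[1+m]⇒T≡x : ∀ m {x} → x * 2 ≡ m * suc m → T m ≡ x
x*2≡m*[1+m]⇒T≡x m eq = *-cancelʳ-≡ _ _ 2 (trans (T*2≡m*[1+m] m) (sym eq))

triangular-odd : ∀ k → TelescopicBothWays (T (1 + 2 * k)) (T (1 + 2 * k + 1)) (T (1 + 2 * k + 2))
triangular-odd k =
  telescopic-both-ways z<s z<s z<s z<s T₀ T₁ T₂
    (coprime-by-linear-relation (1 + 2 * k) (3 + 2 * k) (2 + k) (1 + k) (solve (k ∷ [])))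
    (coprime-by-linear-relation (1 + k) (3 + 2 * k) 2 1 (solve (k ∷ [])))
    (coprime-by-linear-relation (1 + k) (2 + k) 1 1 (solve (k ∷ [])))
  where
  T₀ : T (1 + 2 * k) ≡ (1 + 2 * k) * (1 + k)
  T₀ = x*2≡m*[1+m]⇒T≡x (1 + 2 * k) (solve (k ∷ []))
  T₁ : T (1 + 2 * k + 1) ≡ (1 + k) * (3 + 2 * k)
  T₁ = x*2≡m*[1+m]⇒T≡x (1 + 2 * k + 1) (solve (k ∷ []))
  T₂ : T (1 + 2 * k + 2) ≡ (3 + 2 * k) * (2 + k)
  T₂ = x*2≡m*[1+m]⇒T≡x (1 + 2 * k + 2) (solve (k ∷ []))

triangular-even : ∀ k → TelescopicBothWays (T (2 + 2 * k)) (T (2 + 2 * k + 1)) (T (2 + 2 * k + 2))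
triangular-even k =
  telescopic-both-ways z<s z<s z<s z<s T₀ T₁ T₂
    (coprime-by-linear-relation (1 + k) (2 + k) 1 1 (solve (k ∷ [])))
    (coprime-by-linear-relation (3 + 2 * k) (2 + k) 1 2 (solve (k ∷ [])))
    (coprime-by-linear-relation (3 + 2 * k) (5 + 2 * k) (3 + k) (2 + k) (solve (k ∷ [])))
  where
  T₀ : T (2 + 2 * k) ≡ (1 + k) * (3 + 2 * k)
  T₀ = x*2≡m*[1+m]⇒T≡x (2 + 2 * k) (solve (k ∷ []))
  T₁ : T (2 + 2 * k + 1) ≡ (3 + 2 * k) * (2 + k)
  T₁ = x*2≡m*[1+m]⇒T≡x (2 + 2 * k + 1) (solve (k ∷ []))
  T₂ : T (2 + 2 * k + 2) ≡ (2 + k) * (5 + 2 * k)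
  T₂ = x*2≡m*[1+m]⇒T≡x (2 + 2 * k + 2) (solve (k ∷ []))

even-or-odd : ∀ m → ∃ λ k → m ≡ 2 * k ⊎ m ≡ 1 + 2 * k
even-or-odd zero = 0 , inj₁ refl
even-or-odd (suc m) with even-or-odd m
... | k , inj₁ refl = k , inj₂ refl
... | k , inj₂ refl = suc k , inj₁ (cong suc (sym (+-suc k (k + 0))))

proposition5 : (n : ℕ) → 0 < n →
    Telescopic (T n ∷ T (n + 1) ∷ T (n + 2) ∷ [])
      × Telescopic (T (n + 2) ∷ T (n + 1) ∷ T n ∷ [])
proposition5 (suc m) _ with even-or-odd m
... | k , inj₁ refl = triangular-odd k
... | k , inj₂ refl = triangular-even k
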